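{- Let $P$ be a protocol, $\mathcal R=\mathcal R(P,\gamma^{\max})$, and $r\in\mathcal R$. Assume the ND event $e$ takes place at $(i_0,t)$ in $r$. If $(\mathcal R,r,t')\vDash K_{i_1}\,\mathrm{ndocc}(e)$, then $(i_0,t)\rightsquigarrow(i_1,t')$ in $r$.
   Context: Model: a finite set of processes communicates over a directed network; each channel $i\to j$ has a known integer upper bound $b_{ij}\ge 1$ on transmission time. Time is global and discrete, and every local state contains the current time. In $\gamma^{\max}$, a message sent on $i\to j$ at time $s$ is received at a nondeterministically chosen time in $[s+1,s+b_{ij}]$; processes may receive external inputs, chosen nondeterministically and independently of the past; initial states are arbitrary. A protocol prescribes each process's actions as a function of its local state, and a process's local state is determined by its previous local state and the events (receipts, external inputs) it experiences; $\mathcal R(P,\gamma^{\max})$ is the set of all runs of $P$. A node $(i,t)$ is process $i$ at time $t$; $r_i(t)$ is $i$'s local state at time $t$ in $r$. ND (nondeterministic) events: external inputs and early receives, where a receipt by $j$ at time $s$ of a message sent by $i$ at time $s'$ is early if $s<s'+b_{ij}$. Knowledge: $(\mathcal R,r,t)\vDash K_i\varphi$ iff $(\mathcal R,r',t)\vDash\varphi$ for all $r'\in\mathcal R$ with $r'_i(t)=r_i(t)$. $(\mathcal R,r,t)\vDash\mathrm{ndocc}(e)$ iff $e$ occurred in $r$ at some time $\le t$ as an ND event. Syncausality $\rightsquigarrow$ in $r$: the smallest relation on nodes such that (1) $(i,t)\rightsquigarrow(i,t')$ if $t\le t'$; (2) $(i,t)\rightsquigarrow(j,t')$ if a message sent at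 $(i,t)$ is received at $(j,t')$; (3) $(i,t)\rightsquigarrow(j,t+b_{ij})$ if $j$ is a neighbour of $i$ and $i$ sends no message to $j$ at time $t$; (4) it is transitive. -}

module Defs where

open import Data.Nat using (ℕ; zero; suc; _+_; _≤_; _<_; _≟_)
open import Data.Fin using (Fin; toℕ)
open import Data.Bool using (Bool; true; false; if_then_else_)
open import Data.Maybe using (Maybe; just; nothing)
open import Data.Vec using (Vec; tabulate)
open import Data.Product using (Σ; _×_; _,_)
open import Relation.Nullary.Decidable using (⌊_⌋)
open import Relation.Binary.PropositionalEquality using (_≡_)

-- The model γ^max (bounded communication, global discrete time).
--
-- Local states form an abstract type LState with a time component;
-- the next local state is determined by the previous one and the
-- events of the current round (messages received, external input),
-- via the (arbitrary) update function δ.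

record Context : Set₁ where
  field
    n         : ℕ
    chan      : Fin n → Fin n → Bool
    bound     : Fin n → Fin n → ℕ
    bound-pos : ∀ i j → chan i j ≡ true → 1 ≤ bound i j
    Msg       : Set
    Input     : Set
    LState    : Set
    time      : LState → ℕ
    -- δ j s x E I : new local state of j at time suc s, given its state x
    -- at time s, the messages E received at time suc s (E[k][s'] = message
    -- from k sent at time s', if one is received now) and the external
    -- input I received at time suc s (if any).
    δ         : (j : Fin n) (s : ℕ) → LState
              → Vec (Vec (Maybe Msg) (suc s)) n → Maybe Input → LState
    δ-time    : ∀ j s x E I → time (δ j s x E I) ≡ suc s

Protocol : Context → Set
Protocol C = Fin n → LState → Fin n → Maybe Msg
  where open Context C

module _ (C : Context) (P : Protocol C) where
  open Context C

  Proc : Set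
  Proc = Fin n

  Node : Set
  Node = Proc × ℕ

  sentBy : (Proc → ℕ → LState) → Proc → Proc → ℕ → Maybe Msg
  sentBy st i j s = if chan i j then P i (st i s) j else nothing

  -- the message (if any) sent by k at time s' that j receives at time u,
  -- given states st and delivery times dl
  incoming : (Proc → ℕ → LState) → (Proc → Proc → ℕ → ℕ)
           → Proc → ℕ → Proc → ℕ → Maybe Msg
  incoming st dl j u k s' with sentBy st k j s'
  ... | nothing = nothing
  ... | just m  = if ⌊ dl k j s' ≟ u ⌋ then just m else nothing

  -- A run of P in γ^max.
  --   st  i t   : local state r_i(t)
  --   inp i t   : external input received by i at time t (used for t ≥ 1)
  --   dl i j s  : delivery time of the message sent on i → j at time s
  record Run : Set where
    field
      st     : Proc → ℕ → LState
      inp    : Proc → ℕ → Maybe Input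
      dl     : Proc → Proc → ℕ → ℕ
      init   : ∀ i → time (st i 0) ≡ 0
      dl-ok  : ∀ i j s m → sentBy st i j s ≡ just m
             → (s < dl i j s) × (dl i j s ≤ s + bound i j)
      step   : ∀ j s → st j (suc s)
             ≡ δ j s (st j s)
                 (tabulate λ k → tabulate λ (s' : Fin (suc s)) →
                    incoming st dl j (suc s) k (toℕ s'))
                 (inp j (suc s))

  open Run

  sent : Run → Proc → Proc → ℕ → Maybe Msg
  sent r = sentBy (st r)

  Receives : Run → Proc → Proc → ℕ → ℕ → Msg → Set
  Receives r i j s u m = (sent r i j s ≡ just m) × (dl r i j s ≡ u)

  -- Potentially-ND events (identified by location and content).
  data Event : Set where
    ev-input : (j : Proc) (u : ℕ) (x : Input) → Event
    ev-recv  : (i j : Proc) (s u : ℕ) (m : Msg) → Event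

  -- e takes place at node (j , u) in r as an ND event
  -- (external input, or early receive).
  NDAt : Run → Event → Proc → ℕ → Set
  NDAt r (ev-input j u x)   j' u' =
    (j ≡ j') × (u ≡ u') × (Σ ℕ λ v → u ≡ suc v) × (inp r j u ≡ just x)
  NDAt r (ev-recv i j s u m) j' u' =
    (j ≡ j') × (u ≡ u') × Receives r i j s u m × (u < s + bound i j)

  Formula : Set₁
  Formula = Run → ℕ → Set

  ndocc : Event → Formula
  ndocc e r t = Σ Proc λ j → Σ ℕ λ u → (u ≤ t) × NDAt r e j u

  K : Proc → Formula → Formula
  K i φ r t = (r' : Run) → st r' i t ≡ st r i t → φ r' t

  data _⊢_⇝_ (r : Run) : Node → Node → Set where
    loc   : ∀ {i t t'} → t ≤ t' → r ⊢ (i , t) ⇝ (i , t')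
    msg   : ∀ {i j t t' m} → Receives r i j t t' m → r ⊢ (i , t) ⇝ (j , t')
    bnd   : ∀ {i j t} → chan i j ≡ true → sent r i j t ≡ nothing
          → r ⊢ (i , t) ⇝ (j , t + bound i j)
    trans : ∀ {a b c} → r ⊢ a ⇝ b → r ⊢ b ⇝ c → r ⊢ a ⇝ c

module Submission where

-- Let Q be the syncausal past of (i₁,t') in r.  We build a
-- second run r' of P ("surgery" on r) which coincides with r on every node
-- of Q, but in which nothing nondeterministic happens outside Q: nodes
-- outside Q receive no external input, and a message is delivered early
-- only if its receipt lies in Q.  Since (i₁,t') ∈ Q, i₁ cannot tell r and
-- r' apart at time t', so e occurs in r' as an ND event, hence at a node of
-- Q; that node is (i₀,t), because an event determines where it happens.

open import Defs
open import Data.Nat using (ℕ; zero; suc; _+_; _≤_; _<_; _≤′_; ≤′-refl; ≤′-step; z≤n; s≤s; s≤s⁻¹; _≟_; _≤?_)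
open import Data.Nat.Properties
  using (≤-refl; ≤-trans; <⇒≤; <⇒≱; <-irrefl; n≤1+n; m≤m+n; m<m+n; +-suc; +-monoʳ-≤; ≤⇒≤′; m≤n⇒m<n∨m≡n)
open import Data.Fin using (Fin; toℕ)
open import Data.Fin.Properties using (any?; toℕ<n) renaming (_≟_ to _≟ᶠ_)
import Data.Bool as Bool
open import Data.Bool using (true; false; if_then_else_)
open import Data.Bool.Properties using (¬-not)
open import Data.Maybe using (Maybe; just; nothing)
open import Data.Vec using (tabulate)
open import Data.Vec.Properties using (tabulate-cong)
open import Data.Product using (∃; _×_; _,_; proj₁; proj₂)
open import Data.Sum using (_⊎_; inj₁; inj₂)
open import Data.Empty using (⊥-elim)
open import Function using (_∘_)
open import Relation.Nullary using (Dec; yes; no; ¬_)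
open import Relation.Nullary.Decidable using (map′; _⊎-dec_; _×-dec_; ⌊_⌋)
open import Relation.Binary.PropositionalEquality
  using (_≡_; _≢_; refl; sym; cong; cong₂; subst; module ≡-Reasoning)
  renaming (trans to ≡-trans)

module _ (C : Context) (P : Protocol C) where
  open Context C

  deliver : Maybe Msg → ℕ → ℕ → Maybe Msg
  deliver nothing  d u = nothing
  deliver (just m) d u = if ⌊ d ≟ u ⌋ then just m else nothing

  incoming-deliver : ∀ st dl j u k s →
    incoming C P st dl j u k s ≡ deliver (sentBy C P st k j s) (dl k j s) u
  incoming-deliver st dl j u k s with sentBy C P st k j s
  ... | nothing = refl
  ... | just _  = refl

  deliver-cong : ∀ {x x' d d' u} → x ≡ x' → (∀ {m} → x ≡ just m → d ≡ d') →
                 deliver x d u ≡ deliver x' d' u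
  deliver-cong {nothing}         refl _    = refl
  deliver-cong {just m} {u = u} refl same = cong (λ d → deliver (just m) d u) (same refl)

  deliver-nothing : ∀ {x d u} → (∀ {m} → x ≡ just m → d ≢ u) → deliver x d u ≡ nothing
  deliver-nothing {nothing} _ = refl
  deliver-nothing {just m} {d} {u} notNow with d ≟ u
  ... | yes d≡u = ⊥-elim (notNow refl d≡u)
  ... | no  _   = refl

  sending-uses-channel : ∀ st {k j s m} → sentBy C P st k j s ≡ just m → chan k j ≡ true
  sending-uses-channel st {k} {j} sent with chan k j | sent
  ... | true | _ = refl
  ... | false | ()

  silent-channel : ∀ st {k j s} → chan k j ≡ false → sentBy C P st k j s ≡ nothing
  silent-channel st no-chan rewrite no-chan = refl

  sentBy-cong : ∀ st st' k j s → st k s ≡ st' k s → sentBy C P st k j s ≡ sentBy C P st' k j s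
  sentBy-cong st st' k j s same = cong (λ x → if chan k j then P k x j else nothing) same

  incoming-cong : ∀ st st' dl j u k s → st k s ≡ st' k s →
                  incoming C P st dl j u k s ≡ incoming C P st' dl j u k s
  incoming-cong st st' dl j u k s same = begin
    incoming C P st dl j u k s                    ≡⟨ incoming-deliver st dl j u k s ⟩
    deliver (sentBy C P st k j s) (dl k j s) u    ≡⟨ deliver-cong (sentBy-cong st st' k j s same) (λ _ → refl) ⟩
    deliver (sentBy C P st' k j s) (dl k j s) u   ≡⟨ incoming-deliver st' dl j u k s ⟨
    incoming C P st' dl j u k s                   ∎
    where open ≡-Reasoning

  place : Event C P → Node C P
  place (ev-input j u _)    = j , u
  place (ev-recv _ j _ u _) = j , u

  NDAt-place : ∀ {r e j u} → NDAt C P r e j u → (j , u) ≡ place e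
  NDAt-place {e = ev-input _ _ _}     (refl , refl , _) = refl
  NDAt-place {e = ev-recv _ _ _ _ _} (refl , refl , _) = refl

  Admissible : (Proc C P → Proc C P → ℕ → ℕ) → Set
  Admissible dl = ∀ i j s → chan i j ≡ true → (s < dl i j s) × (dl i j s ≤ s + bound i j)

  -- Every choice of initial states, external inputs and admissible delivery
  -- times is realised by a run of P: the local states are then computed
  -- round by round from δ.
  module Realise (init : Proc C P → LState) (init-time : ∀ i → time (init i) ≡ 0)
                 (inp : Proc C P → ℕ → Maybe Input) (dl : Proc C P → Proc C P → ℕ → ℕ)
                 (admissible : Admissible dl) where

    next : (Proc C P → ℕ → LState) → ℕ → Proc C P → LState
    next hist t j = δ j t (hist j t)
      (tabulate λ k → tabulate λ (s : Fin (suc t)) → incoming C P hist dl j (suc t) k (toℕ s))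
      (inp j (suc t))

    -- history t j u is the state of j at time min u t.
    history : ℕ → Proc C P → ℕ → LState
    history zero    j u = init j
    history (suc t) j u with u ≤? t
    ... | yes _ = history t j u
    ... | no  _ = next (history t) t j

    history-now : ∀ t j → history (suc t) j (suc t) ≡ next (history t) t j
    history-now t j with suc t ≤? t
    ... | yes t<t = ⊥-elim (<-irrefl refl t<t)
    ... | no  _   = refl

    history-stable : ∀ {t u} j → u ≤ t → history t j u ≡ history u j u
    history-stable {zero}  j z≤n = refl
    history-stable {suc t} {u} j u≤1+t with u ≤? t | m≤n⇒m<n∨m≡n u≤1+t
    ... | yes u≤t | _          = history-stable j u≤t
    ... | no  u≰t | inj₁ u<1+t = ⊥-elim (u≰t (s≤s⁻¹ u<1+t))
    ... | no  _   | inj₂ refl  = sym (history-now t j)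

    states : Proc C P → ℕ → LState
    states j u = history u j u

    run : Run C P
    run = record
      { st    = states
      ; inp   = inp
      ; dl    = dl
      ; init  = init-time
      ; dl-ok = λ i j s m sent → admissible i j s (sending-uses-channel states {i} {j} {s} sent)
      ; step  = λ j t → ≡-trans (history-now t j)
                  (cong (λ E → δ j t (states j t) E (inp j (suc t)))
                    (tabulate-cong λ k → tabulate-cong λ s →
                      incoming-cong (history t) states dl j (suc t) k (toℕ s)
                        (history-stable k (s≤s⁻¹ (toℕ<n s)))))
      }

  module _ (r : Run C P) where
    open Run r using (dl; dl-ok)

    _⇝_ : Node C P → Node C P → Set
    x ⇝ y = _⊢_⇝_ C P r x y

    -- The node of j that a send of k at time s reaches syncausally: the
    -- receipt of the message if one is sent, otherwise the deadline s + bₖⱼ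
    -- (clauses (2) and (3) of syncausality).
    arrival : Proc C P → Proc C P → ℕ → ℕ
    arrival k j s with sent C P r k j s
    ... | just _  = dl k j s
    ... | nothing = s + bound k j

    arrival-sent : ∀ {k j s m} → sent C P r k j s ≡ just m → arrival k j s ≡ dl k j s
    arrival-sent {k} {j} {s} sent≡ with sent C P r k j s
    arrival-sent refl | just _ = refl

    arrival-silent : ∀ {k j s} → sent C P r k j s ≡ nothing → arrival k j s ≡ s + bound k j
    arrival-silent {k} {j} {s} sent≡ with sent C P r k j s
    arrival-silent refl | nothing = refl

    arrival⇝ : ∀ {k j s} → chan k j ≡ true → (k , s) ⇝ (j , arrival k j s)
    arrival⇝ {k} {j} {s} c with sent C P r k j s in sent≡
    ... | just _  = msg (sent≡ , refl)
    ... | nothing = bnd c sent≡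

    arrival-bounds : ∀ {k j s} → chan k j ≡ true → (s < arrival k j s) × (arrival k j s ≤ s + bound k j)
    arrival-bounds {k} {j} {s} c with sent C P r k j s in sent≡
    ... | just m  = dl-ok k j s m sent≡
    ... | nothing = m<m+n s (bound-pos k j c) , ≤-refl

    arrival-after : ∀ {k j s} → chan k j ≡ true → s < arrival k j s
    arrival-after = proj₁ ∘ arrival-bounds

    -- Reaches is a
    -- normal form of syncausality into (i₁,t'): wait at a process, or
    -- follow one channel step, until (i₁,t') is hit.  Every step moves
    -- forward in time, and nodes after t' do not reach (i₁,t'), which bounds
    -- the search.
    module Past (i₁ : Proc C P) (t' : ℕ) where

      data Reaches : Node C P → Set where
        here : Reaches (i₁ , t')
        wait : ∀ {j u} → Reaches (j , suc u) → Reaches (j , u)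
        hop  : ∀ {j k u} → chan j k ≡ true → Reaches (k , arrival j k u) → Reaches (j , u)

      Reaches⇒⇝ : ∀ {x} → Reaches x → x ⇝ (i₁ , t')
      Reaches⇒⇝ here      = loc ≤-refl
      Reaches⇒⇝ (wait R)  = trans (loc (n≤1+n _)) (Reaches⇒⇝ R)
      Reaches⇒⇝ (hop c R) = trans (arrival⇝ c) (Reaches⇒⇝ R)

      wait* : ∀ {j t u} → t ≤′ u → Reaches (j , u) → Reaches (j , t)
      wait* ≤′-refl         R = R
      wait* (≤′-step t≤u) R = wait* t≤u (wait R)

      ⇝-Reaches : ∀ {x y} → x ⇝ y → Reaches y → Reaches x
      ⇝-Reaches (loc t≤u) R = wait* (≤⇒≤′ t≤u) R
      ⇝-Reaches (msg {j = k} (sent≡ , dl≡)) R =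
        hop (sending-uses-channel (Run.st r) sent≡)
            (subst (λ v → Reaches (k , v)) (sym (≡-trans (arrival-sent sent≡) dl≡)) R)
      ⇝-Reaches (bnd {j = k} c silent) R =
        hop c (subst (λ v → Reaches (k , v)) (sym (arrival-silent silent)) R)
      ⇝-Reaches (trans x⇝y y⇝z) R = ⇝-Reaches x⇝y (⇝-Reaches y⇝z R)

      Reaches-before : ∀ {j u} → Reaches (j , u) → u ≤ t'
      Reaches-before here      = ≤-refl
      Reaches-before (wait R)  = ≤-trans (n≤1+n _) (Reaches-before R)
      Reaches-before (hop c R) = ≤-trans (<⇒≤ (arrival-after c)) (Reaches-before R)

      FirstStep : Proc C P → ℕ → Set
      FirstStep j u = ((j ≡ i₁) × (u ≡ t'))
                    ⊎ (Reaches (j , suc u) ⊎ (∃ λ k → (chan j k ≡ true) × Reaches (k , arrival j k u)))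

      first-step : ∀ {j u} → Reaches (j , u) → FirstStep j u
      first-step here              = inj₁ (refl , refl)
      first-step (wait R)          = inj₂ (inj₁ R)
      first-step (hop {k = k} c R) = inj₂ (inj₂ (k , c , R))

      take-step : ∀ {j u} → FirstStep j u → Reaches (j , u)
      take-step (inj₁ (refl , refl))      = here
      take-step (inj₂ (inj₁ R))           = wait R
      take-step (inj₂ (inj₂ (_ , c , R))) = hop c R

      -- Decide Reaches by searching forward; the fuel f bounds the number of
      -- steps left before passing t'.
      reaches? : ∀ f {j u} → t' < f + u → Dec (Reaches (j , u))
      reaches? zero    t'<u = no λ R → <⇒≱ t'<u (Reaches-before R)
      reaches? (suc f) {j} {u} t'<1+f+u =
        map′ take-step first-step
          ((j ≟ᶠ i₁ ×-dec u ≟ t') ⊎-dec (reaches? f t'<f+1+u ⊎-dec any? hop?))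
        where
        t'<f+1+u : t' < f + suc u
        t'<f+1+u = subst (t' <_) (sym (+-suc f u)) t'<1+f+u

        hop? : ∀ k → Dec ((chan j k ≡ true) × Reaches (k , arrival j k u))
        hop? k with chan j k Bool.≟ true
        ... | no  ¬c = no (¬c ∘ proj₁)
        ... | yes c  = map′ (c ,_) proj₂
                         (reaches? f (≤-trans t'<f+1+u (+-monoʳ-≤ f (arrival-after c))))

      past? : ∀ x → Dec (x ⇝ (i₁ , t'))
      past? (j , u) = map′ Reaches⇒⇝ (λ x⇝ → ⇝-Reaches x⇝ here) (reaches? (suc t') (s≤s (m≤m+n t' u)))

    -- Surgery on r along a decidable set Q of nodes closed under syncausal
    -- predecessors: remove every external input outside Q, and delay to the
    -- deadline every delivery whose arrival lies outside Q.
    module Surgery (Q : Node C P → Set) (Q? : ∀ x → Dec (Q x))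
                   (past-closed : ∀ {x y} → x ⇝ y → Q y → Q x) where

      quiet-inp : Proc C P → ℕ → Maybe Input
      quiet-inp j u with Q? (j , u)
      ... | yes _ = Run.inp r j u
      ... | no  _ = nothing

      late-dl : Proc C P → Proc C P → ℕ → ℕ
      late-dl k j s with Q? (j , arrival k j s)
      ... | yes _ = arrival k j s
      ... | no  _ = s + bound k j

      quiet-inp-inside : ∀ {j u} → Q (j , u) → quiet-inp j u ≡ Run.inp r j u
      quiet-inp-inside {j} {u} q with Q? (j , u)
      ... | yes _ = refl
      ... | no ¬q = ⊥-elim (¬q q)

      quiet-inp-just : ∀ {j u x} → quiet-inp j u ≡ just x → Q (j , u)
      quiet-inp-just {j} {u} inp≡ with Q? (j , u)
      ... | yes q = q
      quiet-inp-just () | no _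

      late-dl-cases : ∀ k j s → (Q (j , arrival k j s) × (late-dl k j s ≡ arrival k j s))
                              ⊎ (¬ Q (j , arrival k j s) × (late-dl k j s ≡ s + bound k j))
      late-dl-cases k j s with Q? (j , arrival k j s)
      ... | yes q = inj₁ (q , refl)
      ... | no ¬q = inj₂ (¬q , refl)

      late-dl-admissible : Admissible late-dl
      late-dl-admissible k j s c with late-dl-cases k j s
      ... | inj₁ (_ , late≡) rewrite late≡ = arrival-bounds c
      ... | inj₂ (_ , late≡) rewrite late≡ = m<m+n s (bound-pos k j c) , ≤-refl

      surgered : Run C P
      surgered = Realise.run (λ i → Run.st r i 0) (Run.init r) quiet-inp late-dl late-dl-admissible

      AgreeUpTo : ℕ → Set
      AgreeUpTo n = ∀ {j u} → u ≤ n → Q (j , u) → Run.st surgered j u ≡ Run.st r j u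

      -- If k's send to j arrives inside Q, k sends the same message in both
      -- runs (the sending node is in Q as well).
      same-send : ∀ {n k j s} → AgreeUpTo n → s ≤ n → Q (j , arrival k j s) →
                  sent C P surgered k j s ≡ sent C P r k j s
      same-send {k = k} {j} {s} agree s≤n q with chan k j Bool.≟ true
      ... | yes c = sentBy-cong (Run.st surgered) (Run.st r) k j s
                      (agree s≤n (past-closed (arrival⇝ c) q))
      ... | no ¬c = ≡-trans (silent-channel (Run.st surgered) {k} {j} {s} (¬-not ¬c))
                            (sym (silent-channel (Run.st r) {k} {j} {s} (¬-not ¬c)))

      -- Inside Q a process receives the same messages in both runs: a send
      -- arriving in Q is unchanged, and any other send is received neither
      -- in r (its arrival is outside Q) nor in the surgered run (it is
      -- delivered at the deadline, which is then not in Q either).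
      incoming-agree : ∀ {n j u} → AgreeUpTo n → Q (j , u) → ∀ k s → s ≤ n →
        incoming C P (Run.st surgered) late-dl j u k s ≡ incoming C P (Run.st r) dl j u k s
      incoming-agree {j = j} {u} agree q k s s≤n = begin
        incoming C P (Run.st surgered) late-dl j u k s
          ≡⟨ incoming-deliver (Run.st surgered) late-dl j u k s ⟩
        deliver (sent C P surgered k j s) (late-dl k j s) u
          ≡⟨ same-receipt (late-dl-cases k j s) ⟩
        deliver (sent C P r k j s) (dl k j s) u
          ≡⟨ incoming-deliver (Run.st r) dl j u k s ⟨
        incoming C P (Run.st r) dl j u k s
          ∎
        where
        open ≡-Reasoning

        same-receipt : (Q (j , arrival k j s) × (late-dl k j s ≡ arrival k j s))
                     ⊎ (¬ Q (j , arrival k j s) × (late-dl k j s ≡ s + bound k j)) →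
                     deliver (sent C P surgered k j s) (late-dl k j s) u ≡ deliver (sent C P r k j s) (dl k j s) u
        same-receipt (inj₁ (q-arr , late≡arr)) =
          deliver-cong same (λ sent≡ → ≡-trans late≡arr (arrival-sent (≡-trans (sym same) sent≡)))
          where same = same-send agree s≤n q-arr
        same-receipt (inj₂ (¬q-arr , late≡deadline)) =
          ≡-trans (deliver-nothing surgered-late) (sym (deliver-nothing r-late))
          where
          surgered-late : ∀ {m} → sent C P surgered k j s ≡ just m → late-dl k j s ≢ u
          surgered-late sent≡ late≡u =
            ¬q-arr (past-closed (loc (proj₂ (arrival-bounds (sending-uses-channel (Run.st surgered) {s = s} sent≡))))
                                (subst (λ v → Q (j , v)) (≡-trans (sym late≡u) late≡deadline) q))

          r-late : ∀ {m} → sent C P r k j s ≡ just m → dl k j s ≢ u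
          r-late sent≡ dl≡u = ¬q-arr (subst (λ v → Q (j , v)) (sym (≡-trans (arrival-sent sent≡) dl≡u)) q)

      agree-step : ∀ {n j} → AgreeUpTo n → Q (j , suc n) →
                   Run.st surgered j (suc n) ≡ Run.st r j (suc n)
      agree-step {n} {j} agree q = begin
        Run.st surgered j (suc n)
          ≡⟨ Run.step surgered j n ⟩
        _ ≡⟨ cong₂ (λ x E → δ j n x E (quiet-inp j (suc n)))
                   (agree ≤-refl (past-closed (loc (n≤1+n n)) q))
                   (tabulate-cong λ k → tabulate-cong λ s →
                      incoming-agree agree q k (toℕ s) (s≤s⁻¹ (toℕ<n s))) ⟩
        _ ≡⟨ cong (δ j n (Run.st r j n) _) (quiet-inp-inside q) ⟩
        _ ≡⟨ Run.step r j n ⟨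
        Run.st r j (suc n)
          ∎
        where open ≡-Reasoning

      agree-upto : ∀ n → AgreeUpTo n
      agree-upto zero    z≤n     q = refl
      agree-upto (suc n) u≤1+n q with m≤n⇒m<n∨m≡n u≤1+n
      ... | inj₁ u<1+n = agree-upto n (s≤s⁻¹ u<1+n) q
      ... | inj₂ refl  = agree-step (agree-upto n) q

      agree : ∀ {j u} → Q (j , u) → Run.st surgered j u ≡ Run.st r j u
      agree = agree-upto _ ≤-refl

      nd-inside : ∀ {e j u} → NDAt C P surgered e j u → Q (j , u)
      nd-inside {ev-input j u x} (refl , refl , _ , inp≡) = quiet-inp-just inp≡
      nd-inside {ev-recv k j s u m} (refl , refl , (_ , late≡u) , early) with late-dl-cases k j s
      ... | inj₁ (q , late≡arr)       = subst (λ v → Q (j , v)) (≡-trans (sym late≡arr) late≡u) q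
      ... | inj₂ (_ , late≡deadline) = ⊥-elim (<-irrefl (≡-trans (sym late≡u) late≡deadline) early)

      -- If a process at a node of Q knows that e occurred as an ND event,
      -- then e occurred in r inside Q: it occurs in the surgered run, which
      -- the process cannot tell apart from r, and there only inside Q.
      known-inside : ∀ {i₁ t' e j u} → Q (i₁ , t') → K C P i₁ (ndocc C P e) r t' →
                     NDAt C P r e j u → Q (j , u)
      known-inside q knows nd with knows surgered (agree q)
      ... | _ , _ , _ , nd' = subst Q (≡-trans (NDAt-place nd') (sym (NDAt-place nd))) (nd-inside nd')

-- Apply the surgery to
-- the syncausal past of (i₁,t'), which is decidable and past-closed.
mainTheorem3 : (C : Context) (P : Protocol C) (r : Run C P)
    (e : Event C P) (i₀ i₁ : Proc C P) (t t' : ℕ)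
    → NDAt C P r e i₀ t
    → K C P i₁ (ndocc C P e) r t'
    → _⊢_⇝_ C P r (i₀ , t) (i₁ , t')
mainTheorem3 C P r e i₀ i₁ t t' nd knows =
  known-inside (loc ≤-refl) knows nd
  where
  open Past C P r i₁ t' using (past?)
  open Surgery C P r (λ x → _⊢_⇝_ C P r x (i₁ , t')) past? trans using (known-inside)
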